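{- The map $\phi$ is a bijection between $\Delta\setminus\mathcal{I}$ and $Q=\{(a,b,d,e)\in\mathbb{N}^4 : d<a,\ \gcd(d,e)=1\}$.
   Context: $\mathbb{N}$ denotes the positive integers. A partition is identified with its Ferrers diagram, a finite subset of $\mathbb{N}^2$ (points called cells). A partition is triangular if there are real $r,s>0$ such that it is exactly the set of points of $\mathbb{N}^2$ on or below the line $x/r+y/s=1$; $\Delta$ is the set of all triangular partitions (including the empty one). A cell $c\in\tau$ is removable if $\tau\setminus\{c\}$ is triangular. $\mathcal{I}$ is the set of partitions all of whose parts equal $1$, including the empty partition. For $\tau\in\Delta\setminus\mathcal{I}$, let $c=(a,b)$ be the rightmost removable cell of $\tau$ (one has $a>1$), and let $(d,e)$ be the unique pair of relatively prime positive integers such that $(a-d,b+e)\in\mathbb{N}^2\setminus\tau$ and, for all positive integers $d',e'$ with $e'/d'<e/d$, the point $(a-d',b+e')$ does not belong to $\mathbb{N}^2\setminus\tau$. Define $\phi(\tau)=(a,b,d,e)$.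
   Formalization: The parameters r and s of the line defining triangular partitions and removable cells range over the positive rationals rather than the positive reals. -}

module Defs where

open import Data.Nat using (ℕ; zero; suc; _+_; _*_; _∸_; _≤_; _<_)
open import Data.Nat.GCD using (gcd)
open import Data.Nat.Coprimality using (Coprime)
open import Data.Integer using (+_)
open import Data.Rational as ℚ using (ℚ; _/_)
open import Data.List using (List; []; _∷_)
open import Data.List.Relation.Unary.All using (All)
open import Data.List.Relation.Unary.Linked using (Linked)
open import Data.Product using (Σ; _×_; _,_)
open import Data.Empty using (⊥)
open import Relation.Nullary using (¬_)
open import Relation.Binary.PropositionalEquality using (_≡_)
open import Function.Bundles using (_⇔_)

-- Its Ferrers diagram is the set of cells (x , y) with
-- 1 ≤ y ≤ ℓ and 1 ≤ x ≤ λ_y (x = column, y = row).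
IsPartition : List ℕ → Set
IsPartition λs = All (1 ≤_) λs × Linked (λ p q → q ≤ p) λs

Mem : List ℕ → ℕ → ℕ → Set
Mem []       x y             = ⊥
Mem (p ∷ ps) x zero          = ⊥
Mem (p ∷ ps) x (suc zero)    = (1 ≤ x) × (x ≤ p)
Mem (p ∷ ps) x (suc (suc y)) = Mem ps x (suc y)

⟦_⟧ : ℕ → ℚ
⟦ n ⟧ = + n / 1

-- A set S ⊆ ℕ² (ℕ = positive integers) is triangular if there are r , s > 0
-- with S = { (x , y) ∈ ℕ² : x / r + y / s ≤ 1 }.  The inequality
-- x/r + y/s ≤ 1 is written, after multiplying by r s > 0, as x s + y r ≤ r s.
-- r , s range over ℚ.
IsTriangularSet : (ℕ → ℕ → Set) → Set
IsTriangularSet S =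
  Σ ℚ λ r → Σ ℚ λ s → (ℚ.0ℚ ℚ.< r) × (ℚ.0ℚ ℚ.< s) ×
    (∀ x y → S x y ⇔ ((1 ≤ x) × (1 ≤ y) ×
                      ((⟦ x ⟧ ℚ.* s ℚ.+ ⟦ y ⟧ ℚ.* r) ℚ.≤ (r ℚ.* s))))

InΔ : List ℕ → Set
InΔ τ = IsPartition τ × IsTriangularSet (Mem τ)

InI : List ℕ → Set
InI τ = All (_≡ 1) τ

Removable : List ℕ → ℕ → ℕ → Set
Removable τ a b =
  Mem τ a b × IsTriangularSet (λ x y → Mem τ x y × ¬ ((x ≡ a) × (y ≡ b)))

RightmostRemovable : List ℕ → ℕ → ℕ → Set
RightmostRemovable τ a b =
  Removable τ a b × (∀ a' b' → Removable τ a' b' → a' ≤ a)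

-- (a - d , b + e) ∈ ℕ² ∖ τ   (a - d must be a positive integer, i.e. d < a)
OutsideShift : List ℕ → ℕ → ℕ → ℕ → ℕ → Set
OutsideShift τ a b d e = (d < a) × (1 ≤ b + e) × ¬ Mem τ (a ∸ d) (b + e)

Φ : List ℕ → ℕ × ℕ × ℕ × ℕ → Set
Φ τ (a , b , d , e) =
  RightmostRemovable τ a b ×
  (1 ≤ d) × (1 ≤ e) × Coprime d e ×
  OutsideShift τ a b d e ×
  (∀ d' e' → 1 ≤ d' → 1 ≤ e' → e' * d < e * d' → ¬ OutsideShift τ a b d' e')

InQ : ℕ × ℕ × ℕ × ℕ → Set
InQ (a , b , d , e) =
  (1 ≤ a) × (1 ≤ b) × (1 ≤ d) × (1 ≤ e) × (d < a) × (gcd d e ≡ 1)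

{-# OPTIONS --safe #-}
-- A triangular partition is the set of cells with U x + V y ≤ T for some positive integers
-- U , V , T.  For q = (a , b , d , e) ∈ Q, the cells strictly below the line through (a , b) of
-- slope -e/d, together with the cells on it no higher than b, form a triangular partition τ_q
-- with φ(τ_q) = q: removing (a , b) cuts that line down to height b - 1, a removable cell further
-- right would force the boundary of τ_q minus that cell to be both steeper and flatter than e/d,
-- and (d , e) is the flattest step from (a , b) out of τ_q.  Conversely, for τ ∈ Δ ∖ 𝓘 take,
-- among the crossings (x + d , y) ∈ τ, (x , y + e) ∉ τ, one of least slope e/d and then of least
-- width d.  Minimality forces gcd(d , e) = 1 and makes the line through (x + d , y) of slope -e/d
-- separate τ from its complement as above, so τ = τ_q for q = (x + d , y , d , e).  Since φ(τ)
-- depends only on τ, the two maps are mutually inverse.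

module Submission where

open import Defs
open import Data.Nat as ℕ using (ℕ; zero; suc; _+_; _*_; _∸_; _≤_; _<_; z≤n; s≤s; NonZero)
import Data.Nat.Properties as ℕP
open import Data.Integer as ℤ using (+_; -[1+_])
import Data.Integer.Properties as ℤP
open import Data.Integer.Tactic.RingSolver as ℤSolver using ()
open import Data.Rational as ℚ using (ℚ; mkℚ)
import Data.Rational.Properties as ℚP
open import Data.Rational.Unnormalised as ℚᵘ using (ℚᵘ; mkℚᵘ; *≤*; *<*)
import Data.Rational.Unnormalised.Properties as ℚᵘP
open import Data.Nat.DivMod using (_/_; m/n*n≤m; m*n/n≡m; /-monoˡ-≤)
open import Data.List using (List; []; _∷_; applyUpTo; upTo; cartesianProduct)
open import Data.List.Membership.Propositional using (_∈_)
open import Data.List.Membership.Propositional.Properties using (∈-cartesianProduct⁺; ∈-upTo⁺)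
open import Data.List.Relation.Unary.Any using (here; there)
open import Data.List.Relation.Unary.All using ([]; _∷_)
open import Data.List.Relation.Unary.All.Properties using (applyUpTo⁺₁)
open import Data.List.Relation.Unary.Linked as Linked using (Linked; []; [-]; _∷_)
open import Data.Nat.Divisibility using (_∣_; divides; ∣⇒≤; ∣-antisym)
open import Data.Nat.Coprimality as Coprime using (Coprime; coprime-divisor)
open import Data.Sum using (_⊎_; inj₁; inj₂; reduce)
open import Data.Empty using (⊥; ⊥-elim)
open import Relation.Nullary using (¬_; yes; no; Dec)
open import Relation.Nullary.Decidable using (_×-dec_; ¬?)
open import Relation.Unary using (Decidable)
open import Relation.Binary using (tri<; tri≈; tri>)
open import Data.Product using (Σ; ∃; _×_; _,_; proj₁; proj₂)
open import Data.Product.Function.NonDependent.Propositional using (_×-⇔_)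
open import Data.Nat.Tactic.RingSolver as ℕSolver using ()
open import Function.Bundles using (_⇔_; mk⇔; Equivalence)
open import Function.Properties.Equivalence using () renaming (refl to ⇔-refl; sym to ⇔-sym; trans to ⇔-trans)
open import Relation.Binary.PropositionalEquality
open Equivalence
open import Function.Base using (_∘_)

-- Triangular sets with integer coefficients

Triangle : ℕ → ℕ → ℕ → ℕ → ℕ → Set
Triangle U V T x y = (1 ≤ x) × (1 ≤ y) × (U * x + V * y ≤ T)

record IntegralTriangle (S : ℕ → ℕ → Set) : Set where
  field
    U V T : ℕ
    U-pos : 1 ≤ U
    V-pos : 1 ≤ V
    cells : ∀ x y → S x y ⇔ Triangle U V T x y

module _ (x y rn rd sn sd : ℕ) where
  private
    R S : ℚᵘ
    R = mkℚᵘ (+ rn) rd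
    S = mkℚᵘ (+ sn) sd

    cross : ∀ (x y rn rd sn sd : ℤ.ℤ) →
            ((x ℤ.* sn) ℤ.* rd ℤ.+ (y ℤ.* rn) ℤ.* sd) ℤ.* (rd ℤ.* sd)
            ≡ ((sn ℤ.* rd) ℤ.* x ℤ.+ (rn ℤ.* sd) ℤ.* y) ℤ.* (rd ℤ.* sd)
    cross = ℤSolver.solve-∀

  line-ℚᵘ⇔ℕ : ((+ x ℚᵘ./ 1) ℚᵘ.* S ℚᵘ.+ (+ y ℚᵘ./ 1) ℚᵘ.* R ℚᵘ.≤ R ℚᵘ.* S)
              ⇔ (sn * suc rd * x + rn * suc sd * y ≤ rn * sn)
  line-ℚᵘ⇔ℕ = mk⇔
    (λ { (*≤* le) → ℕP.*-cancelʳ-≤ A B K (ℤP.drop‿+≤+ (subst₂ ℤ._≤_ lhs rhs le)) })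
    (λ le → *≤* (subst₂ ℤ._≤_ (sym lhs) (sym rhs) (ℤ.+≤+ (ℕP.*-monoˡ-≤ K le))))
    where
    A B K : ℕ
    A = sn * suc rd * x + rn * suc sd * y
    B = rn * sn
    K = suc rd * suc sd
    pos-K : + K ≡ + suc rd ℤ.* + suc sd
    pos-K = ℤP.pos-* (suc rd) (suc sd)
    pos-*³ : ∀ a b c → + (a * b * c) ≡ + a ℤ.* + b ℤ.* + c
    pos-*³ a b c = trans (ℤP.pos-* (a * b) c) (cong (ℤ._* + c) (ℤP.pos-* a b))
    lhs : ℚᵘ.↥ ((+ x ℚᵘ./ 1) ℚᵘ.* S ℚᵘ.+ (+ y ℚᵘ./ 1) ℚᵘ.* R) ℤ.* ℚᵘ.↧ (R ℚᵘ.* S) ≡ + (A * K)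
    lhs = begin
      -- the denominator 1 * suc rd of (+ x / 1) * S normalises to suc (rd + 0)
      ((+ x ℤ.* + sn) ℤ.* + suc (rd + 0) ℤ.+ (+ y ℤ.* + rn) ℤ.* + suc (sd + 0)) ℤ.* (+ suc rd ℤ.* + suc sd)
        ≡⟨ cong₂ (λ i j → ((+ x ℤ.* + sn) ℤ.* + suc i ℤ.+ (+ y ℤ.* + rn) ℤ.* + suc j) ℤ.* (+ suc rd ℤ.* + suc sd))
                 (ℕP.+-identityʳ rd) (ℕP.+-identityʳ sd) ⟩
      ((+ x ℤ.* + sn) ℤ.* + suc rd ℤ.+ (+ y ℤ.* + rn) ℤ.* + suc sd) ℤ.* (+ suc rd ℤ.* + suc sd)
        ≡⟨ cross (+ x) (+ y) (+ rn) (+ suc rd) (+ sn) (+ suc sd) ⟩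
      ((+ sn ℤ.* + suc rd) ℤ.* + x ℤ.+ (+ rn ℤ.* + suc sd) ℤ.* + y) ℤ.* (+ suc rd ℤ.* + suc sd)
        ≡⟨ sym (cong₂ ℤ._*_ (trans (ℤP.pos-+ (sn * suc rd * x) _) (cong₂ ℤ._+_ (pos-*³ sn (suc rd) x) (pos-*³ rn (suc sd) y))) pos-K) ⟩
      + A ℤ.* + K
        ≡⟨ sym (ℤP.pos-* A K) ⟩
      + (A * K) ∎
      where open ≡-Reasoning
    rhs : ℚᵘ.↥ (R ℚᵘ.* S) ℤ.* ℚᵘ.↧ ((+ x ℚᵘ./ 1) ℚᵘ.* S ℚᵘ.+ (+ y ℚᵘ./ 1) ℚᵘ.* R) ≡ + (B * K)
    rhs = begin
      (+ rn ℤ.* + sn) ℤ.* (+ suc (sd + 0) ℤ.* + suc (rd + 0))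
        ≡⟨ cong₂ (λ i j → (+ rn ℤ.* + sn) ℤ.* (+ suc i ℤ.* + suc j)) (ℕP.+-identityʳ sd) (ℕP.+-identityʳ rd) ⟩
      (+ rn ℤ.* + sn) ℤ.* (+ suc sd ℤ.* + suc rd)
        ≡⟨ cong ((+ rn ℤ.* + sn) ℤ.*_) (ℤP.*-comm (+ suc sd) (+ suc rd)) ⟩
      (+ rn ℤ.* + sn) ℤ.* (+ suc rd ℤ.* + suc sd)
        ≡⟨ sym (trans (ℤP.pos-* B K) (cong₂ ℤ._*_ (ℤP.pos-* rn sn) pos-K)) ⟩
      + (B * K) ∎
      where open ≡-Reasoning

line-ℚ⇔ℕ : ∀ {r s rn rd sn sd} →
           ℚ.toℚᵘ r ℚᵘ.≃ mkℚᵘ (+ rn) rd → ℚ.toℚᵘ s ℚᵘ.≃ mkℚᵘ (+ sn) sd → ∀ x y →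
           (⟦ x ⟧ ℚ.* s ℚ.+ ⟦ y ⟧ ℚ.* r ℚ.≤ r ℚ.* s) ⇔ (sn * suc rd * x + rn * suc sd * y ≤ rn * sn)
line-ℚ⇔ℕ {r} {s} {rn} {rd} {sn} {sd} r≃ s≃ x y =
  ⇔-trans (mk⇔ toℚᵘ-line fromℚᵘ-line) (line-ℚᵘ⇔ℕ x y rn rd sn sd)
  where
  R S : ℚᵘ
  R = mkℚᵘ (+ rn) rd
  S = mkℚᵘ (+ sn) sd
  lhs≃ : ℚ.toℚᵘ (⟦ x ⟧ ℚ.* s ℚ.+ ⟦ y ⟧ ℚ.* r) ℚᵘ.≃ (+ x ℚᵘ./ 1) ℚᵘ.* S ℚᵘ.+ (+ y ℚᵘ./ 1) ℚᵘ.* R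
  lhs≃ = ℚᵘP.≃-trans (ℚP.toℚᵘ-homo-+ (⟦ x ⟧ ℚ.* s) (⟦ y ⟧ ℚ.* r))
           (ℚᵘP.+-cong (ℚᵘP.≃-trans (ℚP.toℚᵘ-homo-* ⟦ x ⟧ s) (ℚᵘP.*-cong (ℚP.toℚᵘ-fromℚᵘ (+ x ℚᵘ./ 1)) s≃))
                       (ℚᵘP.≃-trans (ℚP.toℚᵘ-homo-* ⟦ y ⟧ r) (ℚᵘP.*-cong (ℚP.toℚᵘ-fromℚᵘ (+ y ℚᵘ./ 1)) r≃)))
  rhs≃ : ℚ.toℚᵘ (r ℚ.* s) ℚᵘ.≃ R ℚᵘ.* S
  rhs≃ = ℚᵘP.≃-trans (ℚP.toℚᵘ-homo-* r s) (ℚᵘP.*-cong r≃ s≃)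
  toℚᵘ-line : ⟦ x ⟧ ℚ.* s ℚ.+ ⟦ y ⟧ ℚ.* r ℚ.≤ r ℚ.* s →
              (+ x ℚᵘ./ 1) ℚᵘ.* S ℚᵘ.+ (+ y ℚᵘ./ 1) ℚᵘ.* R ℚᵘ.≤ R ℚᵘ.* S
  toℚᵘ-line h = ℚᵘP.≤-respʳ-≃ rhs≃ (ℚᵘP.≤-respˡ-≃ lhs≃ (ℚP.toℚᵘ-mono-≤ h))
  fromℚᵘ-line : (+ x ℚᵘ./ 1) ℚᵘ.* S ℚᵘ.+ (+ y ℚᵘ./ 1) ℚᵘ.* R ℚᵘ.≤ R ℚᵘ.* S →
                ⟦ x ⟧ ℚ.* s ℚ.+ ⟦ y ⟧ ℚ.* r ℚ.≤ r ℚ.* s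
  fromℚᵘ-line h = ℚP.toℚᵘ-cancel-≤ (ℚᵘP.≤-respʳ-≃ (ℚᵘP.≃-sym rhs≃) (ℚᵘP.≤-respˡ-≃ (ℚᵘP.≃-sym lhs≃) h))

triangular⇒integral : ∀ {S} → IsTriangularSet S → IntegralTriangle S
triangular⇒integral (mkℚ (+ suc rn) rd _ , mkℚ (+ suc sn) sd _ , _ , _ , cells) = record
  { U = suc sn * suc rd ; V = suc rn * suc sd ; T = suc rn * suc sn
  ; U-pos = s≤s z≤n ; V-pos = s≤s z≤n
  ; cells = λ x y → ⇔-trans (cells x y) (⇔-refl ×-⇔ ⇔-refl ×-⇔ line-ℚ⇔ℕ ℚᵘP.≃-refl ℚᵘP.≃-refl x y)
  }
triangular⇒integral (mkℚ (+ 0) _ _ , _ , ℚ.*<* (ℤ.+<+ ()) , _)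
triangular⇒integral (mkℚ -[1+ _ ] _ _ , _ , ℚ.*<* () , _)
triangular⇒integral (mkℚ (+ suc _) _ _ , mkℚ (+ 0) _ _ , _ , ℚ.*<* (ℤ.+<+ ()) , _)
triangular⇒integral (mkℚ (+ suc _) _ _ , mkℚ -[1+ _ ] _ _ , _ , ℚ.*<* () , _)

integral⇒triangular : ∀ {S} (t : IntegralTriangle S) → 1 ≤ IntegralTriangle.T t → IsTriangularSet S
integral⇒triangular record { U = suc U' ; V = suc V' ; T = T ; cells = cells } (s≤s _) =
  r , s , positive U' , positive V' ,
  λ x y → ⇔-trans (cells x y) (⇔-refl ×-⇔ ⇔-refl ×-⇔ ⇔-sym (⇔-trans (line-ℚ⇔ℕ {rn = T} {U'} {T} {V'} r≃ s≃ x y) (scale x y)))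
  where
  R S : ℚᵘ
  R = mkℚᵘ (+ T) U'
  S = mkℚᵘ (+ T) V'
  r s : ℚ
  r = ℚ.fromℚᵘ R
  s = ℚ.fromℚᵘ S
  r≃ : ℚ.toℚᵘ r ℚᵘ.≃ R
  r≃ = ℚP.toℚᵘ-fromℚᵘ R
  s≃ : ℚ.toℚᵘ s ℚᵘ.≃ S
  s≃ = ℚP.toℚᵘ-fromℚᵘ S
  positive : ∀ W → ℚ.0ℚ ℚ.< ℚ.fromℚᵘ (mkℚᵘ (+ T) W)
  positive W = ℚP.toℚᵘ-cancel-<
    (ℚᵘP.<-respʳ-≃ (ℚᵘP.≃-sym (ℚP.toℚᵘ-fromℚᵘ (mkℚᵘ (+ T) W))) (*<* (ℤ.+<+ (s≤s z≤n))))
  distrib : ∀ x y → T * suc U' * x + T * suc V' * y ≡ T * (suc U' * x + suc V' * y)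
  distrib x y = trans (cong₂ _+_ (ℕP.*-assoc T (suc U') x) (ℕP.*-assoc T (suc V') y))
                      (sym (ℕP.*-distribˡ-+ T (suc U' * x) (suc V' * y)))
  scale : ∀ x y → (T * suc U' * x + T * suc V' * y ≤ T * T) ⇔ (suc U' * x + suc V' * y ≤ T)
  scale x y = mk⇔
    (λ le → ℕP.*-cancelˡ-≤ T (subst (_≤ T * T) (distrib x y) le))
    (λ le → subst (_≤ T * T) (sym (distrib x y)) (ℕP.*-monoʳ-≤ T le))

IntegralTriangle-resp-⇔ : ∀ {S S'} → (∀ x y → S x y ⇔ S' x y) → IntegralTriangle S' → IntegralTriangle S
IntegralTriangle-resp-⇔ S⇔S' t = record
  { U = U ; V = V ; T = T ; U-pos = U-pos ; V-pos = V-pos ; cells = λ x y → ⇔-trans (S⇔S' x y) (cells x y) }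
  where open IntegralTriangle t

private
  shiftˣ : ∀ U V x y dx → U * (x + dx) + V * y ≡ U * x + V * y + U * dx
  shiftˣ = ℕSolver.solve-∀

  shiftʸ : ∀ U V x y dy → U * x + V * (y + dy) ≡ U * x + V * y + V * dy
  shiftʸ = ℕSolver.solve-∀

  step-< : ∀ {A p q T} → A + p ≤ T → ¬ (A + q ≤ T) → p < q
  step-< {A} A+p≤T A+q≰T = ℕP.≰⇒> λ q≤p → A+q≰T (ℕP.≤-trans (ℕP.+-monoʳ-≤ A q≤p) A+p≤T)

module _ {T : ℕ} (U V x y dx dy : ℕ) where

  crossing-< : U * (x + dx) + V * y ≤ T → ¬ (U * x + V * (y + dy) ≤ T) → U * dx < V * dy
  crossing-< inside outside =
    step-< (subst (_≤ T) (shiftˣ U V x y dx) inside) (outside ∘ subst (_≤ T) (sym (shiftʸ U V x y dy)))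

  crossing-> : ¬ (U * (x + dx) + V * y ≤ T) → U * x + V * (y + dy) ≤ T → V * dy < U * dx
  crossing-> outside inside =
    step-< (subst (_≤ T) (shiftʸ U V x y dy) inside) (outside ∘ subst (_≤ T) (sym (shiftˣ U V x y dx)))

-- Partitions cut out by an integral triangle

≤∸⇒+≤ : ∀ {m n o} → 1 ≤ m → m ≤ n ∸ o → m + o ≤ n
≤∸⇒+≤ {m} 1≤m m≤n∸o =
  ℕP.m≤o∸n⇒m+n≤o m (ℕP.<⇒≤ (ℕP.m∸n≢0⇒n<m (ℕP.m<n⇒n≢0 (ℕP.<-≤-trans 1≤m m≤n∸o)))) m≤n∸o

≤[∸]/⇔*+≤ : ∀ {x} U z T .{{_ : NonZero U}} → 1 ≤ x → (x ≤ (T ∸ z) / U) ⇔ (U * x + z ≤ T)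
≤[∸]/⇔*+≤ {x} U z T 1≤x = mk⇔
  (λ le → ≤∸⇒+≤ (ℕP.≤-trans 1≤x (ℕP.m≤n*m x U)) (subst (_≤ T ∸ z) (ℕP.*-comm x U)
            (ℕP.≤-trans (ℕP.*-monoˡ-≤ U le) (m/n*n≤m (T ∸ z) U))))
  (λ le → subst (_≤ (T ∸ z) / U) (m*n/n≡m x U)
            (/-monoˡ-≤ U (subst (_≤ T ∸ z) (ℕP.*-comm U x) (ℕP.m+n≤o⇒m≤o∸n (U * x) le))))

Mem⇒positive : ∀ τ {x y} → Mem τ x y → (1 ≤ x) × (1 ≤ y)
Mem⇒positive (p ∷ ps) {y = suc zero}    (1≤x , _) = 1≤x , s≤s z≤n
Mem⇒positive (p ∷ ps) {y = suc (suc y)} m         = proj₁ (Mem⇒positive ps m) , s≤s z≤n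

partition-ext : ∀ {τ τ'} → IsPartition τ → IsPartition τ' → (∀ x y → Mem τ x y ⇔ Mem τ' x y) → τ ≡ τ'
partition-ext {[]}     {[]}       _                _                  cells = refl
partition-ext {[]}     {p' ∷ _}   _                (1≤p' ∷ _ , _)     cells = ⊥-elim (from (cells 1 1) (s≤s z≤n , 1≤p'))
partition-ext {p ∷ _}  {[]}       (1≤p ∷ _ , _)    _                  cells = ⊥-elim (to (cells 1 1) (s≤s z≤n , 1≤p))
partition-ext {p ∷ ps} {p' ∷ ps'} (1≤p ∷ ps⁺ , ps↓) (1≤p' ∷ ps'⁺ , ps'↓) cells =
  cong₂ _∷_ (ℕP.≤-antisym (proj₂ (to (cells p 1) (1≤p , ℕP.≤-refl))) (proj₂ (from (cells p' 1) (1≤p' , ℕP.≤-refl))))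
            (partition-ext (ps⁺ , Linked.tail ps↓) (ps'⁺ , Linked.tail ps'↓) tail-cells)
  where
  tail-cells : ∀ x y → Mem ps x y ⇔ Mem ps' x y
  tail-cells x zero    = mk⇔ (λ m → ⊥-elim (ℕP.n≮0 (proj₂ (Mem⇒positive ps m))))
                             (λ m → ⊥-elim (ℕP.n≮0 (proj₂ (Mem⇒positive ps' m))))
  tail-cells x (suc y) = cells x (suc (suc y))

Mem-applyUpTo : ∀ f n x j → Mem (applyUpTo f n) x (suc j) ⇔ ((j < n) × (1 ≤ x) × (x ≤ f j))
Mem-applyUpTo f zero    x j       = mk⇔ (λ ()) (λ ())
Mem-applyUpTo f (suc n) x zero    = mk⇔ (λ (1≤x , x≤f0) → s≤s z≤n , 1≤x , x≤f0) proj₂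
Mem-applyUpTo f (suc n) x (suc j) = ⇔-trans (Mem-applyUpTo (λ i → f (suc i)) n x j)
  (mk⇔ (λ (j<n , rest) → s≤s j<n , rest) (λ { (s≤s j<n , rest) → j<n , rest }))

applyUpTo-isPartition : ∀ f n → (∀ {j} → j < n → 1 ≤ f j) → (∀ j → f (suc j) ≤ f j) →
                        IsPartition (applyUpTo f n)
applyUpTo-isPartition f n pos anti = applyUpTo⁺₁ f n pos , decreasing f n anti
  where
  decreasing : ∀ f n → (∀ j → f (suc j) ≤ f j) → Linked (λ p q → q ≤ p) (applyUpTo f n)
  decreasing f zero          anti = []
  decreasing f (suc zero)    anti = [-]
  decreasing f (suc (suc n)) anti = anti 0 ∷ decreasing (λ i → f (suc i)) (suc n) (λ j → anti (suc j))

module _ (U V T : ℕ) .{{_ : NonZero U}} .{{_ : NonZero V}} where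

  trianglePartition : List ℕ
  trianglePartition = applyUpTo (λ j → (T ∸ V * suc j) / U) ((T ∸ U) / V)

  private
    row-bound : ∀ j → (j < (T ∸ U) / V) ⇔ (U * 1 + V * suc j ≤ T)
    row-bound j = ⇔-trans (≤[∸]/⇔*+≤ V U T (s≤s z≤n)) (mk⇔ (subst (_≤ T) swap) (subst (_≤ T) (sym swap)))
      where
      swap : V * suc j + U ≡ U * 1 + V * suc j
      swap = trans (ℕP.+-comm (V * suc j) U) (cong (_+ V * suc j) (sym (ℕP.*-identityʳ U)))

    cell-bound : ∀ {x} j → 1 ≤ x → (x ≤ (T ∸ V * suc j) / U) ⇔ (U * x + V * suc j ≤ T)
    cell-bound j = ≤[∸]/⇔*+≤ U (V * suc j) T

  trianglePartition-isPartition : IsPartition trianglePartition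
  trianglePartition-isPartition = applyUpTo-isPartition _ _
    (λ {j} j<rows → from (cell-bound j ℕP.≤-refl) (to (row-bound j) j<rows))
    (λ j → /-monoˡ-≤ U (ℕP.∸-monoʳ-≤ T (ℕP.*-monoʳ-≤ V (ℕP.n≤1+n (suc j)))))

  Mem-trianglePartition : ∀ x y → Mem trianglePartition x y ⇔ Triangle U V T x y
  Mem-trianglePartition x zero    = mk⇔ (λ m → ⊥-elim (ℕP.n≮0 (proj₂ (Mem⇒positive trianglePartition m))))
                                        (λ ())
  Mem-trianglePartition x (suc j) = ⇔-trans (Mem-applyUpTo _ _ x j) (mk⇔
    (λ (_ , 1≤x , x≤row) → 1≤x , s≤s z≤n , to (cell-bound j 1≤x) x≤row)
    (λ (1≤x , _ , inside) → from (row-bound j) (first-column 1≤x inside) , 1≤x , from (cell-bound j 1≤x) inside))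
    where
    first-column : 1 ≤ x → U * x + V * suc j ≤ T → U * 1 + V * suc j ≤ T
    first-column 1≤x = ℕP.≤-trans (ℕP.+-monoˡ-≤ (V * suc j) (ℕP.*-monoʳ-≤ U 1≤x))

integral⇒partition : ∀ {S} (t : IntegralTriangle S) → 1 ≤ IntegralTriangle.T t →
                     Σ (List ℕ) λ τ → InΔ τ × (∀ x y → Mem τ x y ⇔ S x y)
integral⇒partition {S} t@record { U = U ; V = V ; T = T ; U-pos = 1≤U ; V-pos = 1≤V } 1≤T =
  τ , (trianglePartition-isPartition U V T , integral⇒triangular τ-triangle 1≤T) ,
  λ x y → ⇔-trans (Mem-trianglePartition U V T x y) (⇔-sym (IntegralTriangle.cells t x y))
  where
  instance
    U≢0 = ℕ.>-nonZero 1≤U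
    V≢0 = ℕ.>-nonZero 1≤V
  τ : List ℕ
  τ = trianglePartition U V T
  τ-triangle : IntegralTriangle (Mem τ)
  τ-triangle = record { U = U ; V = V ; T = T ; U-pos = 1≤U ; V-pos = 1≤V ; cells = Mem-trianglePartition U V T }

Mem⇒¬InI : ∀ τ {x y} → Mem τ x y → 2 ≤ x → ¬ InI τ
Mem⇒¬InI (p ∷ ps) {y = suc zero}    (_ , x≤p) 2≤x (refl ∷ _)   = ℕP.<-irrefl refl (ℕP.≤-trans 2≤x x≤p)
Mem⇒¬InI (p ∷ ps) {y = suc (suc y)} m         2≤x (_ ∷ ps≡1) = Mem⇒¬InI ps m 2≤x ps≡1

head≤1⇒InI : ∀ {p ps} → IsPartition (p ∷ ps) → p ≤ 1 → InI (p ∷ ps)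
head≤1⇒InI {ps = []}    (1≤p ∷ [] , _)       p≤1 = ℕP.≤-antisym p≤1 1≤p ∷ []
head≤1⇒InI {ps = _ ∷ _} (1≤p ∷ ps⁺ , q≤p ∷ ↓) p≤1 = ℕP.≤-antisym p≤1 1≤p ∷ head≤1⇒InI (ps⁺ , ↓) (ℕP.≤-trans q≤p p≤1)

¬InI⇒Mem-2-1 : ∀ {τ} → IsPartition τ → ¬ InI τ → Mem τ 2 1
¬InI⇒Mem-2-1 {[]}    _     ¬I = ⊥-elim (¬I [])
¬InI⇒Mem-2-1 {p ∷ _} τ-ptn ¬I with 2 ℕ.≤? p
... | yes 2≤p = s≤s z≤n , 2≤p
... | no  2≰p = ⊥-elim (¬I (head≤1⇒InI τ-ptn (ℕP.≤-pred (ℕP.≰⇒> 2≰p))))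

-- Levels along a step (d , e)

level : ℕ → ℕ → ℕ → ℕ → ℕ
level d e x y = e * x + d * y

level-step : ∀ d e x y dx dy → level d e x (y + dy) + e * dx ≡ level d e (x + dx) y + d * dy
level-step = step
  where
  step : ∀ d e x y dx dy → e * x + d * (y + dy) + e * dx ≡ e * (x + dx) + d * y + d * dy
  step = ℕSolver.solve-∀

+-≡⇒<⇔> : ∀ {m n p q} → m + p ≡ n + q → (m < n ⇔ q < p)
+-≡⇒<⇔> {m} {n} {p} {q} eq = mk⇔
  (λ m<n → ℕP.+-cancelˡ-< n q p (subst (_< n + p) eq (ℕP.+-monoˡ-< p m<n)))
  (λ q<p → ℕP.+-cancelʳ-< p m n (subst (_< n + p) (sym eq) (ℕP.+-monoʳ-< n q<p)))

level-step-<⇔ : ∀ {d e x y dx dy} → (level d e x (y + dy) < level d e (x + dx) y) ⇔ (d * dy < e * dx)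
level-step-<⇔ {d} {e} {x} {y} {dx} {dy} = +-≡⇒<⇔> (level-step d e x y dx dy)

level-along : ∀ d e x y → level d e x (y + e) ≡ level d e (x + d) y
level-along d e x y = ℕP.+-cancelʳ-≡ (e * d) _ _
  (trans (level-step d e x y d e) (cong (λ z → level d e (x + d) y + z) (ℕP.*-comm d e)))

level-diag : ∀ {d e a} b → d ≤ a → level d e (a ∸ d) (b + e) ≡ level d e a b
level-diag {d} {e} {a} b d≤a = trans (level-along d e (a ∸ d) b) (cong (λ x → level d e x b) (ℕP.m∸n+n≡m d≤a))

level-<-mono : ∀ {d e x y x' y'} → 1 ≤ e → x < x' → y ≤ y' → level d e x y < level d e x' y'
level-<-mono {d} {e} 1≤e x<x' y≤y' = ℕP.+-mono-<-≤ (ℕP.*-monoʳ-< e x<x') (ℕP.*-monoʳ-≤ d y≤y')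
  where instance _ = ℕ.>-nonZero 1≤e

level-<-monoʸ : ∀ {d e x y x' y'} → 1 ≤ d → x ≤ x' → y < y' → level d e x y < level d e x' y'
level-<-monoʸ {d} {e} 1≤d x≤x' y<y' = ℕP.+-mono-≤-< (ℕP.*-monoʳ-≤ e x≤x') (ℕP.*-monoʳ-< d y<y')
  where instance _ = ℕ.>-nonZero 1≤d

-- If U d ≤ V e, then d (U x + V y) + κ x = V · level d e x y where U d + κ = V e; so moving right
-- without raising the level does not increase U x + V y.
level-dominates : ∀ {U V d e x₁ y₁ x₂ y₂} → 1 ≤ d → U * d ≤ V * e → x₁ ≤ x₂ →
                  level d e x₂ y₂ ≤ level d e x₁ y₁ → U * x₂ + V * y₂ ≤ U * x₁ + V * y₁
level-dominates {U} {V} {d} {e} {x₁} {y₁} {x₂} {y₂} 1≤d Ud≤Ve x₁≤x₂ L₂≤L₁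
  with ℕP.m≤n⇒∃[o]m+o≡n Ud≤Ve
... | κ , Ud+κ≡Ve = ℕP.*-cancelˡ-≤ d {{ℕ.>-nonZero 1≤d}} (ℕP.+-cancelʳ-≤ (κ * x₂) _ _ (begin
    d * (U * x₂ + V * y₂) + κ * x₂  ≡⟨ scaled x₂ y₂ ⟩
    V * level d e x₂ y₂             ≤⟨ ℕP.*-monoʳ-≤ V L₂≤L₁ ⟩
    V * level d e x₁ y₁             ≡⟨ scaled x₁ y₁ ⟨
    d * (U * x₁ + V * y₁) + κ * x₁  ≤⟨ ℕP.+-monoʳ-≤ (d * (U * x₁ + V * y₁)) (ℕP.*-monoʳ-≤ κ x₁≤x₂) ⟩
    d * (U * x₁ + V * y₁) + κ * x₂  ∎))
  where
  open ℕP.≤-Reasoning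
  regroup : ∀ U V d κ x y → d * (U * x + V * y) + κ * x ≡ (U * d + κ) * x + V * (d * y)
  regroup = ℕSolver.solve-∀
  expand : ∀ V e d x y → V * e * x + V * (d * y) ≡ V * (e * x + d * y)
  expand = ℕSolver.solve-∀
  scaled : ∀ x y → d * (U * x + V * y) + κ * x ≡ V * level d e x y
  scaled x y = trans (regroup U V d κ x y)
                     (trans (cong (λ z → z * x + V * (d * y)) Ud+κ≡Ve) (expand V e d x y))

<⇒∃+suc : ∀ {m n} → m < n → ∃ λ k → m + suc k ≡ n
<⇒∃+suc {m} m<n with ℕP.m≤n⇒∃[o]m+o≡n m<n
... | k , eq = k , trans (ℕP.+-suc m k) eq

level-≡-gap : ∀ {d e x y x' y'} → 1 ≤ e → Coprime d e →
              level d e x y ≡ level d e x' y' → x < x' → (x + d ≤ x') × (y' + e ≤ y)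
level-≡-gap {d} {e} {x} {y} {x'} {y'} 1≤e cop eq x<x'
  with <⇒∃+suc x<x' | <⇒∃+suc (ℕP.≰⇒> λ y≤y' → ℕP.<-irrefl eq (level-<-mono {d} 1≤e x<x' y≤y'))
... | i , refl | j , refl = ℕP.+-monoʳ-≤ x (∣⇒≤ d∣i) , ℕP.+-monoʳ-≤ y' (∣⇒≤ e∣j)
  where
  ei≡dj : e * suc i ≡ d * suc j
  ei≡dj = ℕP.+-cancelˡ-≡ (level d e x y) _ _
    (trans (level-step d e x y' (suc i) (suc j)) (cong (_+ d * suc j) (sym eq)))
  d∣i : d ∣ suc i
  d∣i = coprime-divisor cop (divides (suc j) (trans ei≡dj (ℕP.*-comm d (suc j))))
  e∣j : e ∣ suc j
  e∣j = coprime-divisor (Coprime.sym cop) (divides (suc i) (trans (sym ei≡dj) (ℕP.*-comm e (suc i))))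

-- The partition φ⁻¹(q)

digits-≤⇔ : ∀ {c h l y} → y ≤ l → h ≤ c → (suc c * l + y ≤ suc c * c + h) ⇔ (l < c ⊎ (l ≡ c × y ≤ h))
digits-≤⇔ {c} {h} {l} {y} y≤l h≤c = mk⇔ to′ from′
  where
  K : ℕ
  K = suc c
  below-next : ∀ m {z} → z < K → K * m + z < K * suc m
  below-next m {z} z<K = begin-strict
    K * m + z  <⟨ ℕP.+-monoʳ-< (K * m) z<K ⟩
    K * m + K  ≡⟨ ℕP.+-comm (K * m) K ⟩
    K + K * m  ≡⟨ ℕP.*-suc K m ⟨
    K * suc m  ∎
    where open ℕP.≤-Reasoning
  to′ : K * l + y ≤ K * c + h → l < c ⊎ (l ≡ c × y ≤ h)
  to′ le with ℕP.<-cmp l c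
  ... | tri< l<c _ _ = inj₁ l<c
  ... | tri≈ _ refl _ = inj₂ (refl , ℕP.+-cancelˡ-≤ (K * c) y h le)
  ... | tri> _ _ c<l = ⊥-elim (ℕP.<-irrefl refl (begin-strict
    K * c + h  <⟨ below-next c (s≤s h≤c) ⟩
    K * suc c  ≤⟨ ℕP.*-monoʳ-≤ K c<l ⟩
    K * l      ≤⟨ ℕP.m≤m+n (K * l) y ⟩
    K * l + y  ≤⟨ le ⟩
    K * c + h  ∎))
    where open ℕP.≤-Reasoning
  from′ : l < c ⊎ (l ≡ c × y ≤ h) → K * l + y ≤ K * c + h
  from′ (inj₁ l<c) = ℕP.≤-trans (ℕP.<⇒≤ (below-next l (s≤s (ℕP.≤-trans y≤l (ℕP.<⇒≤ l<c)))))
                                 (ℕP.≤-trans (ℕP.*-monoʳ-≤ K l<c) (ℕP.m≤m+n (K * c) h))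
  from′ (inj₂ (refl , y≤h)) = ℕP.+-monoʳ-≤ (K * l) y≤h

UnderLevel : ℕ → ℕ → ℕ → ℕ → ℕ → ℕ → Set
UnderLevel d e c h x y = (1 ≤ x) × (1 ≤ y) × (level d e x y < c ⊎ (level d e x y ≡ c × y ≤ h))

-- The cells of φ⁻¹(a , b , d , e).
Below : ℕ × ℕ × ℕ × ℕ → ℕ → ℕ → Set
Below (a , b , d , e) = UnderLevel d e (level d e a b) b

y≤level : ∀ {d e} x y → 1 ≤ d → y ≤ level d e x y
y≤level {d} {e} x y 1≤d = ℕP.≤-trans (ℕP.m≤n*m y d {{ℕ.>-nonZero 1≤d}}) (ℕP.m≤n+m (d * y) (e * x))

-- Scaling the level by K = c + 1 and adding y as a last digit turns the two-case condition
-- into a single linear inequality.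
UnderLevel-integral : ∀ {d e c h} → 1 ≤ d → 1 ≤ e → h ≤ c → IntegralTriangle (UnderLevel d e c h)
UnderLevel-integral {d} {e} {c} {h} 1≤d 1≤e h≤c = record
  { U = suc c * e ; V = suc (suc c * d) ; T = suc c * c + h
  ; U-pos = ℕP.*-mono-≤ {1} {suc c} (s≤s z≤n) 1≤e ; V-pos = s≤s z≤n
  ; cells = λ x y → ⇔-refl ×-⇔ ⇔-refl ×-⇔ ⇔-sym (⇔-trans
      (mk⇔ (subst (_≤ suc c * c + h) (digits x y)) (subst (_≤ suc c * c + h) (sym (digits x y))))
      (digits-≤⇔ (y≤level {e = e} x y 1≤d) h≤c))
  }
  where
  digits : ∀ x y → suc c * e * x + suc (suc c * d) * y ≡ suc c * level d e x y + y
  digits x y = identity (suc c) d e x y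
    where
    identity : ∀ K d e x y → K * e * x + (1 + K * d) * y ≡ K * (e * x + d * y) + y
    identity = ℕSolver.solve-∀

module _ {a b d e : ℕ} (1≤b : 1 ≤ b) (1≤d : 1 ≤ d) (1≤e : 1 ≤ e) (d<a : d < a) (cop : Coprime d e)
         {τ : List ℕ} (cells : ∀ x y → Mem τ x y ⇔ Below (a , b , d , e) x y) where

  private
    c : ℕ
    c = level d e a b

    1≤a : 1 ≤ a
    1≤a = ℕP.≤-trans 1≤d (ℕP.<⇒≤ d<a)

    1≤c : 1 ≤ c
    1≤c = ℕP.≤-trans 1≤b (y≤level {e = e} a b 1≤d)

    on-row-b : ∀ {x} → level d e x b ≡ c → x ≡ a
    on-row-b {x} eq = ℕP.*-cancelˡ-≡ x a e {{ℕ.>-nonZero 1≤e}} (ℕP.+-cancelʳ-≡ (d * b) _ _ eq)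

    Mem-corner : Mem τ a b
    Mem-corner = from (cells a b) (1≤a , 1≤b , inj₂ (refl , ℕP.≤-refl))

    corner-removed : ∀ x y → (Mem τ x y × ¬ (x ≡ a × y ≡ b)) ⇔ UnderLevel d e c (ℕ.pred b) x y
    corner-removed x y = mk⇔ remove restore
      where
      remove : Mem τ x y × ¬ (x ≡ a × y ≡ b) → UnderLevel d e c (ℕ.pred b) x y
      remove (m , ≢corner) with to (cells x y) m
      ... | 1≤x , 1≤y , inj₁ L<c = 1≤x , 1≤y , inj₁ L<c
      ... | 1≤x , 1≤y , inj₂ (L≡c , y≤b) with y ℕP.≟ b
      ...   | yes refl = ⊥-elim (≢corner (on-row-b L≡c , refl))
      ...   | no  y≢b  = 1≤x , 1≤y , inj₂ (L≡c , ℕP.<⇒≤pred (ℕP.≤∧≢⇒< y≤b y≢b))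
      restore : UnderLevel d e c (ℕ.pred b) x y → Mem τ x y × ¬ (x ≡ a × y ≡ b)
      restore (1≤x , 1≤y , inj₁ L<c) =
        from (cells x y) (1≤x , 1≤y , inj₁ L<c) , λ { (refl , refl) → ℕP.<-irrefl refl L<c }
      restore (1≤x , 1≤y , inj₂ (L≡c , y≤b-1)) =
        from (cells x y) (1≤x , 1≤y , inj₂ (L≡c , ℕP.≤pred⇒≤ y≤b-1)) ,
        λ { (_ , refl) → ℕP.<-irrefl refl (ℕP.m≤pred[n]⇒suc[m]≤n {{ℕ.>-nonZero 1≤b}} y≤b-1) }

  Below-removable : Removable τ a b
  Below-removable = Mem-corner , integral⇒triangular
    (IntegralTriangle-resp-⇔ corner-removed (UnderLevel-integral 1≤d 1≤e (ℕP.≤-trans ℕP.pred[n]≤n (y≤level {e = e} a b 1≤d))))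
    (ℕP.≤-trans 1≤c (ℕP.≤-trans (ℕP.m≤n*m c (suc c)) (ℕP.m≤m+n (suc c * c) (ℕ.pred b))))

  Below-outside : OutsideShift τ a b d e
  Below-outside = d<a , ℕP.≤-trans 1≤b (ℕP.m≤m+n b e) , λ m → off-line (proj₂ (proj₂ (to (cells _ _) m)))
    where
    off-line : ¬ (level d e (a ∸ d) (b + e) < c ⊎ (level d e (a ∸ d) (b + e) ≡ c × b + e ≤ b))
    off-line (inj₁ L<c)       = ℕP.<-irrefl (level-diag b (ℕP.<⇒≤ d<a)) L<c
    off-line (inj₂ (_ , b+e≤b)) = ℕP.<-irrefl refl (ℕP.<-≤-trans (ℕP.m<m+n b 1≤e) b+e≤b)

  Below-minimal : ∀ d' e' → 1 ≤ d' → 1 ≤ e' → e' * d < e * d' → ¬ OutsideShift τ a b d' e'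
  Below-minimal d' e' _ 1≤e' flatter (d'<a , _ , ∉τ) =
    ∉τ (from (cells _ _) (ℕP.m<n⇒0<n∸m d'<a , ℕP.≤-trans 1≤e' (ℕP.m≤n+m e' b) , inj₁ below))
    where
    below : level d e (a ∸ d') (b + e') < c
    below = subst (λ x → level d e (a ∸ d') (b + e') < level d e x b) (ℕP.m∸n+n≡m (ℕP.<⇒≤ d'<a))
              (from (level-step-<⇔ {d} {e}) (subst (_< e * d') (ℕP.*-comm e' d) flatter))

  -- A removable cell (a' , b') right of (a , b) would make the lines of τ ∖ {(a' , b')} both
  -- steeper and flatter than the step (d , e).
  Below-rightmost : ∀ a' b' → Removable τ a' b' → a' ≤ a
  Below-rightmost a' b' (m' , removed-triangular) with a' ℕ.≤? a
  ... | yes a'≤a = a'≤a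
  ... | no  a'≰a = ⊥-elim (ℕP.<-asym (crossing-< U V (a ∸ d) b d e corner-in shifted-corner-out)
                                       (crossing-> U V (a' ∸ d) b' d e removed-out shifted-in))
    where
    open IntegralTriangle (triangular⇒integral removed-triangular) renaming (cells to removed-cells)
    a<a' : a < a'
    a<a' = ℕP.≰⇒> a'≰a
    d≤a' : d ≤ a'
    d≤a' = ℕP.<⇒≤ (ℕP.<-trans d<a a<a')
    corner-in : U * (a ∸ d + d) + V * b ≤ T
    corner-in = subst (λ x → U * x + V * b ≤ T) (sym (ℕP.m∸n+n≡m (ℕP.<⇒≤ d<a)))
      (proj₂ (proj₂ (to (removed-cells a b) (Mem-corner , λ (a≡a' , _) → ℕP.<-irrefl a≡a' a<a'))))
    shifted-corner-out : ¬ (U * (a ∸ d) + V * (b + e) ≤ T)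
    shifted-corner-out inside =
      proj₂ (proj₂ Below-outside) (proj₁ (from (removed-cells _ _) (ℕP.m<n⇒0<n∸m d<a , ℕP.≤-trans 1≤b (ℕP.m≤m+n b e) , inside)))
    removed-out : ¬ (U * (a' ∸ d + d) + V * b' ≤ T)
    removed-out inside = proj₂ (from (removed-cells a' b') (1≤a' , 1≤b' ,
      subst (λ x → U * x + V * b' ≤ T) (ℕP.m∸n+n≡m d≤a') inside)) (refl , refl)
      where
      1≤a' = proj₁ (Mem⇒positive τ m')
      1≤b' = proj₂ (Mem⇒positive τ m')
    shifted-below : Below (a , b , d , e) (a' ∸ d) (b' + e)
    shifted-below with to (cells a' b') m'
    ... | _ , 1≤b' , inj₁ L<c = ℕP.m<n⇒0<n∸m (ℕP.<-trans d<a a<a') , ℕP.≤-trans 1≤b' (ℕP.m≤m+n b' e) ,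
                                inj₁ (subst (_< c) (sym (level-diag b' d≤a')) L<c)
    ... | _ , 1≤b' , inj₂ (L≡c , _) = ℕP.m<n⇒0<n∸m (ℕP.<-trans d<a a<a') , ℕP.≤-trans 1≤b' (ℕP.m≤m+n b' e) ,
                                inj₂ (trans (level-diag b' d≤a') L≡c , proj₂ (level-≡-gap 1≤e cop (sym L≡c) a<a'))
    shifted-in : U * (a' ∸ d) + V * (b' + e) ≤ T
    shifted-in = proj₂ (proj₂ (to (removed-cells _ _) (from (cells _ _) shifted-below ,
      λ (_ , b'+e≡b') → ℕP.<-irrefl (sym b'+e≡b') (ℕP.m<m+n b' 1≤e))))

  Below⇒Φ : Φ τ (a , b , d , e)
  Below⇒Φ = (Below-removable , Below-rightmost) , 1≤d , 1≤e , cop , Below-outside , Below-minimal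

Below-partition : ∀ {q} → InQ q → Σ (List ℕ) λ τ → InΔ τ × (∀ x y → Mem τ x y ⇔ Below q x y)
Below-partition {a , b , d , e} (_ , 1≤b , 1≤d , 1≤e , _) =
  integral⇒partition (UnderLevel-integral 1≤d 1≤e (y≤level {e = e} a b 1≤d)) (ℕP.≤-trans 1≤b (ℕP.m≤n+m b _))

φ-preimage : ∀ {q} → InQ q → Σ (List ℕ) λ τ → InΔ τ × ¬ InI τ × Φ τ q
φ-preimage {a , b , d , e} q∈Q@(_ , 1≤b , 1≤d , 1≤e , d<a , gcd≡1) =
  let τ , τ∈Δ , τ-cells = Below-partition q∈Q
      corner = from (τ-cells a b) (ℕP.≤-trans 1≤d (ℕP.<⇒≤ d<a) , 1≤b , inj₂ (refl , ℕP.≤-refl))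
  in τ , τ∈Δ , Mem⇒¬InI τ corner (ℕP.≤-trans (s≤s 1≤d) d<a) ,
     Below⇒Φ 1≤b 1≤d 1≤e d<a (Coprime.gcd≡1⇒coprime gcd≡1) {τ} τ-cells

-- φ is single-valued

removable-top-of-column : ∀ τ {a b b'} → Removable τ a b → Mem τ a b' → b' ≤ b
removable-top-of-column τ {a} {b} {b'} (m , removed-triangular) m' with b' ℕ.≤? b
... | yes b'≤b = b'≤b
... | no  b'≰b = ⊥-elim (proj₂ (from (cells a b) (Mem⇒positive τ m .proj₁ , Mem⇒positive τ m .proj₂ ,
                          ℕP.≤-trans lower upper)) (refl , refl))
  where
  open IntegralTriangle (triangular⇒integral removed-triangular)
  b<b' : b < b'
  b<b' = ℕP.≰⇒> b'≰b
  upper : U * a + V * b' ≤ T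
  upper = proj₂ (proj₂ (to (cells a b') (m' , λ (_ , b'≡b) → ℕP.<-irrefl (sym b'≡b) b<b')))
  lower : U * a + V * b ≤ U * a + V * b'
  lower = ℕP.+-monoʳ-≤ (U * a) (ℕP.*-monoʳ-≤ V (ℕP.<⇒≤ b<b'))

coprime-slope-injective : ∀ {d e d' e'} → 1 ≤ d → Coprime d e → Coprime d' e' →
                          e' * d ≡ e * d' → d ≡ d' × e ≡ e'
coprime-slope-injective {d} {e} {d'} {e'} 1≤d cop cop' eq =
  d≡d' , sym (ℕP.*-cancelʳ-≡ e' e d {{ℕ.>-nonZero 1≤d}} (trans eq (cong (e *_) (sym d≡d'))))
  where
  d≡d' : d ≡ d'
  d≡d' = ∣-antisym (coprime-divisor cop (divides e' (sym eq))) (coprime-divisor cop' (divides e eq))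

φ-functional : ∀ {τ q q'} → Φ τ q → Φ τ q' → q ≡ q'
φ-functional {τ} {a , b , d , e} {a' , b' , d' , e'}
  ((corner , rightmost) , 1≤d , 1≤e , cop , outside , minimal)
  ((corner' , rightmost') , 1≤d' , 1≤e' , cop' , outside' , minimal')
  with ℕP.≤-antisym (rightmost' a b corner) (rightmost a' b' corner')
... | refl with ℕP.≤-antisym (removable-top-of-column τ corner' (proj₁ corner))
                             (removable-top-of-column τ corner (proj₁ corner'))
... | refl with ℕP.<-cmp (e' * d) (e * d')
... | tri< flatter _ _ = ⊥-elim (minimal d' e' 1≤d' 1≤e' flatter outside')
... | tri> _ _ steeper = ⊥-elim (minimal' d e 1≤d 1≤e steeper outside)
... | tri≈ _ same _ with coprime-slope-injective 1≤d cop cop' same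
... | refl , refl = refl

Φ⇒InQ : ∀ {τ q} → Φ τ q → InQ q
Φ⇒InQ {τ} ((corner , _) , 1≤d , 1≤e , cop , (d<a , _) , _) =
  proj₁ (Mem⇒positive τ (proj₁ corner)) , proj₂ (Mem⇒positive τ (proj₁ corner)) , 1≤d , 1≤e , d<a ,
  Coprime.coprime⇒gcd≡1 cop

-- Least crossings

module _ {A : Set} {P : A → Set} (P? : Decidable P) {_≼_ : A → A → Set}
         (≼-total : ∀ {a b} → P a → P b → a ≼ b ⊎ b ≼ a)
         (≼-trans : ∀ {a b c} → P a → P b → P c → a ≼ b → b ≼ c → a ≼ c) where

  private
    LeastIn : List A → A → Set
    LeastIn xs m = m ∈ xs × P m × (∀ {a} → a ∈ xs → P a → m ≼ a)

    ≼-refl : ∀ {a} → P a → a ≼ a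
    ≼-refl pa = reduce (≼-total pa pa)

    least-or-none : ∀ xs → (∀ {a} → a ∈ xs → ¬ P a) ⊎ ∃ (LeastIn xs)
    least-or-none []       = inj₁ λ ()
    least-or-none (x ∷ xs) with P? x | least-or-none xs
    ... | no ¬px | inj₁ none = inj₁ λ { (here refl) → ¬px ; (there a∈xs) → none a∈xs }
    ... | no ¬px | inj₂ (m , m∈xs , pm , m-least) =
      inj₂ (m , there m∈xs , pm , λ { (here refl) pa → ⊥-elim (¬px pa) ; (there a∈xs) → m-least a∈xs })
    ... | yes px | inj₁ none =
      inj₂ (x , here refl , px , λ { (here refl) _ → ≼-refl px ; (there a∈xs) pa → ⊥-elim (none a∈xs pa) })
    ... | yes px | inj₂ (m , m∈xs , pm , m-least) with ≼-total px pm
    ...   | inj₁ x≼m = inj₂ (x , here refl , px ,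
              λ { (here refl) _ → ≼-refl px ; (there a∈xs) pa → ≼-trans px pm pa x≼m (m-least a∈xs pa) })
    ...   | inj₂ m≼x = inj₂ (m , there m∈xs , pm , λ { (here refl) _ → m≼x ; (there a∈xs) → m-least a∈xs })

  least-in-list : ∀ {xs a} → a ∈ xs → P a → ∃ λ m → m ∈ xs × P m × (∀ {a} → a ∈ xs → P a → m ≼ a)
  least-in-list {xs} a∈xs pa with least-or-none xs
  ... | inj₁ none  = ⊥-elim (none a∈xs pa)
  ... | inj₂ least = least

slope-trans : ∀ {d₁ e₁ d₂ e₂ d₃ e₃} → 1 ≤ d₂ → e₁ * d₂ ≤ e₂ * d₁ → e₂ * d₃ ≤ e₃ * d₂ → e₁ * d₃ ≤ e₃ * d₁
slope-trans {d₁} {e₁} {d₂} {e₂} {d₃} {e₃} 1≤d₂ le₁₂ le₂₃ =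
  ℕP.*-cancelʳ-≤ (e₁ * d₃) (e₃ * d₁) d₂ {{ℕ.>-nonZero 1≤d₂}} (begin
    e₁ * d₃ * d₂  ≡⟨ swap e₁ d₃ d₂ ⟩
    e₁ * d₂ * d₃  ≤⟨ ℕP.*-monoˡ-≤ d₃ le₁₂ ⟩
    e₂ * d₁ * d₃  ≡⟨ swap e₂ d₁ d₃ ⟩
    e₂ * d₃ * d₁  ≤⟨ ℕP.*-monoˡ-≤ d₁ le₂₃ ⟩
    e₃ * d₂ * d₁  ≡⟨ swap e₃ d₂ d₁ ⟩
    e₃ * d₁ * d₂  ∎)
  where
  open ℕP.≤-Reasoning
  swap : ∀ a b c → a * b * c ≡ a * c * b
  swap = ℕSolver.solve-∀

module Crossings (U V T : ℕ) (1≤U : 1 ≤ U) (1≤V : 1 ≤ V) where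

  In : ℕ → ℕ → Set
  In x y = U * x + V * y ≤ T

  Crossing : ℕ × ℕ × ℕ × ℕ → Set
  Crossing (x , y , d , e) = (1 ≤ x) × (1 ≤ y) × (1 ≤ d) × (1 ≤ e) × In (x + d) y × ¬ In x (y + e)

  crossing? : Decidable Crossing
  crossing? (x , y , d , e) =
    1 ℕ.≤? x ×-dec 1 ℕ.≤? y ×-dec 1 ℕ.≤? d ×-dec 1 ℕ.≤? e ×-dec
    U * (x + d) + V * y ℕ.≤? T ×-dec ¬? (U * x + V * (y + e) ℕ.≤? T)

  _≼_ : ℕ × ℕ × ℕ × ℕ → ℕ × ℕ × ℕ × ℕ → Set
  (_ , _ , d , e) ≼ (_ , _ , d' , e') = e * d' ≤ e' * d

  _≼?_ : ∀ s t → Dec (s ≼ t)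
  (_ , _ , d , e) ≼? (_ , _ , d' , e') = e * d' ℕ.≤? e' * d

  ≼-trans : ∀ {s t u} → Crossing t → s ≼ t → t ≼ u → s ≼ u
  ≼-trans {_ , _ , d₁ , e₁} {_ , _ , d₂ , e₂} {_ , _ , d₃ , e₃} (_ , _ , 1≤d₂ , _) =
    slope-trans {d₁} {e₁} {d₂} {e₂} {d₃} {e₃} 1≤d₂

  In⇒x≤T : ∀ {x y} → In x y → x ≤ T
  In⇒x≤T {x} {y} inside = ℕP.≤-trans (ℕP.m≤n*m x U {{ℕ.>-nonZero 1≤U}}) (ℕP.≤-trans (ℕP.m≤m+n (U * x) (V * y)) inside)

  In⇒y≤T : ∀ {x y} → In x y → y ≤ T
  In⇒y≤T {x} {y} inside = ℕP.≤-trans (ℕP.m≤n*m y V {{ℕ.>-nonZero 1≤V}}) (ℕP.≤-trans (ℕP.m≤n+m (V * y) (U * x)) inside)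

  too-high : ∀ {x y} → ¬ In x (y + suc T)
  too-high {y = y} high = ℕP.<-irrefl refl (ℕP.<-≤-trans (ℕP.m≤n+m (suc T) y) (In⇒y≤T high))

  capped : ∀ {x y d e} → Crossing (x , y , d , e) →
           ∃ λ e' → e' ≤ suc T × (x , y , d , e') ≼ (x , y , d , e) × Crossing (x , y , d , e')
  capped {x} {y} {d} {e} t@(1≤x , 1≤y , 1≤d , _ , inside , _) with e ℕ.≤? suc T
  ... | yes e≤1+T = e , e≤1+T , ℕP.≤-refl , t
  ... | no  e≰1+T = suc T , ℕP.≤-refl , ℕP.*-monoˡ-≤ d (ℕP.<⇒≤ (ℕP.≰⇒> e≰1+T)) ,
                    1≤x , 1≤y , 1≤d , s≤s z≤n , inside ,
                    too-high

  opaque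
    box : List (ℕ × ℕ × ℕ × ℕ)
    box = cartesianProduct (upTo (2 + T)) (cartesianProduct (upTo (2 + T)) (cartesianProduct (upTo (2 + T)) (upTo (2 + T))))

    capped-∈-box : ∀ {x y d e} → Crossing (x , y , d , e) → e ≤ suc T → (x , y , d , e) ∈ box
    capped-∈-box {x} {y} {d} (_ , _ , _ , _ , inside , _) e≤1+T =
      ∈-cartesianProduct⁺ (∈-upTo⁺ (below (ℕP.≤-trans (ℕP.m≤m+n x d) (In⇒x≤T inside))))
        (∈-cartesianProduct⁺ (∈-upTo⁺ (below (In⇒y≤T inside)))
          (∈-cartesianProduct⁺ (∈-upTo⁺ (below (ℕP.≤-trans (ℕP.m≤n+m d x) (In⇒x≤T inside))))
            (∈-upTo⁺ (s≤s e≤1+T))))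
      where
      below : ∀ {z} → z ≤ T → z < 2 + T
      below z≤T = s≤s (ℕP.m≤n⇒m≤1+n z≤T)

  width : ℕ × ℕ × ℕ × ℕ → ℕ
  width (_ , _ , d , _) = d

  record LeastCrossing (s : ℕ × ℕ × ℕ × ℕ) : Set where
    field
      crossing    : Crossing s
      least-slope : ∀ {t} → Crossing t → s ≼ t
      least-width : ∀ {t} → Crossing t → t ≼ s → width s ≤ width t

  private
    initial : In 2 1 → Crossing (1 , 1 , 1 , suc T)
    initial in₂₁ = s≤s z≤n , s≤s z≤n , s≤s z≤n , s≤s z≤n , in₂₁ , too-high {1} {1}

  -- Capping the height of a crossing at T + 1 keeps it a crossing, puts it in the box and
  -- does not increase its slope; this extends minimality over the box to all crossings.
  flattest-crossing : In 2 1 → ∃ λ s → s ∈ box × Crossing s × (∀ {t} → Crossing t → s ≼ t)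
  flattest-crossing in₂₁
    with least-in-list crossing? (λ _ _ → ℕP.≤-total _ _) (λ {s} {t} {u} _ t-crossing _ → ≼-trans {s} {t} {u} t-crossing)
                       (capped-∈-box (initial in₂₁) ℕP.≤-refl) (initial in₂₁)
  ... | s , s∈box , s-crossing , s-least-in-box = s , s∈box , s-crossing , s-least
    where
    s-least : ∀ {t} → Crossing t → s ≼ t
    s-least {x , y , d , e} t-crossing with capped t-crossing
    ... | e' , e'≤1+T , t'≼t , t'-crossing =
      ≼-trans {s} {x , y , d , e'} {x , y , d , e} t'-crossing
        (s-least-in-box (capped-∈-box t'-crossing e'≤1+T) t'-crossing) t'≼t

  private
    FlattestCrossing : ℕ × ℕ × ℕ × ℕ → ℕ × ℕ × ℕ × ℕ → Set
    FlattestCrossing s₁ t = Crossing t × t ≼ s₁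

    narrowest : ∀ {s₁} → Crossing s₁ → (∀ {t} → Crossing t → s₁ ≼ t) →
                (∃ λ s → s ∈ box × FlattestCrossing s₁ s × (∀ {t} → t ∈ box → FlattestCrossing s₁ t → width s ≤ width t)) →
                ∃ LeastCrossing
    narrowest {s₁} s₁-crossing s₁-least (s , _ , (s-crossing , s≼s₁) , s-least-in-box) = s , record
      { crossing    = s-crossing
      ; least-slope = λ {t} t-crossing → ≼-trans {s} {s₁} {t} s₁-crossing s≼s₁ (s₁-least t-crossing)
      ; least-width = s-least
      }
      where
      s-least : ∀ {t} → Crossing t → t ≼ s → width s ≤ width t
      s-least {x , y , d , e} t-crossing t≼s with capped t-crossing
      ... | e' , e'≤1+T , t'≼t , t'-crossing =
        s-least-in-box (capped-∈-box t'-crossing e'≤1+T)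
          (t'-crossing , ≼-trans {x , y , d , e'} {x , y , d , e} {s₁} t-crossing t'≼t
                           (≼-trans {x , y , d , e} {s} {s₁} s-crossing t≼s s≼s₁))

  least-crossing : In 2 1 → ∃ LeastCrossing
  least-crossing in₂₁ =
    let s₁ , s₁∈box , s₁-crossing , s₁-least = flattest-crossing in₂₁
    in narrowest s₁-crossing s₁-least
         (least-in-list {P = FlattestCrossing s₁} (λ t → crossing? t ×-dec t ≼? s₁)
                        (λ {s} {t} _ _ → ℕP.≤-total (width s) (width t)) (λ _ _ _ → ℕP.≤-trans)
                        s₁∈box (s₁-crossing , ℕP.≤-refl))

  module _ {xs b d e : ℕ} (least : LeastCrossing (xs , b , d , e)) where
    open LeastCrossing least

    private
      a c : ℕ
      a = xs + d
      c = level d e a b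

      1≤xs : 1 ≤ xs
      1≤xs = proj₁ crossing
      1≤b : 1 ≤ b
      1≤b = proj₁ (proj₂ crossing)
      1≤d : 1 ≤ d
      1≤d = proj₁ (proj₂ (proj₂ crossing))
      1≤e : 1 ≤ e
      1≤e = proj₁ (proj₂ (proj₂ (proj₂ crossing)))
      corner-in : In a b
      corner-in = proj₁ (proj₂ (proj₂ (proj₂ (proj₂ crossing))))
      shifted-out : ¬ In xs (b + e)
      shifted-out = proj₂ (proj₂ (proj₂ (proj₂ (proj₂ crossing))))

      steep : U * d ≤ V * e
      steep = ℕP.<⇒≤ (crossing-< U V xs b d e corner-in shifted-out)

      In-along-level : ∀ {x₁ y₁ x₂ y₂} → x₁ ≤ x₂ → level d e x₂ y₂ ≤ level d e x₁ y₁ → In x₁ y₁ → In x₂ y₂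
      In-along-level x₁≤x₂ L₂≤L₁ = ℕP.≤-trans (level-dominates {U} {V} {d} {e} 1≤d steep x₁≤x₂ L₂≤L₁)

      In-downward-closed : ∀ {x y x' y'} → x ≤ x' → y ≤ y' → In x' y' → In x y
      In-downward-closed x≤x' y≤y' = ℕP.≤-trans (ℕP.+-mono-≤ (ℕP.*-monoʳ-≤ U x≤x') (ℕP.*-monoʳ-≤ V y≤y'))

      no-steeper-crossing : ∀ {x y dx dy} → Crossing (x , y , dx , dy) →
                            ¬ (level d e x (y + dy) < level d e (x + dx) y)
      no-steeper-crossing {dx = dx} {dy} t-crossing lower =
        ℕP.<-irrefl (ℕP.*-comm d dy) (ℕP.<-≤-trans (to (level-step-<⇔ {d} {e}) lower) (least-slope t-crossing))

    In⇒level≤ : ∀ {x y} → 1 ≤ y → In x y → level d e x y ≤ c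
    In⇒level≤ {x} {y} 1≤y inside = ℕP.≮⇒≥ above
      where
      above : ¬ (c < level d e x y)
      above c<L with x ℕ.≤? xs | b + e ℕ.≤? y
      ... | yes x≤xs | _ = shifted-out
            (In-along-level x≤xs (ℕP.≤-trans (ℕP.≤-reflexive (level-along d e xs b)) (ℕP.<⇒≤ c<L)) inside)
      ... | no x≰xs | yes b+e≤y = shifted-out (In-downward-closed (ℕP.<⇒≤ (ℕP.≰⇒> x≰xs)) b+e≤y inside)
      ... | no x≰xs | no b+e≰y with <⇒∃+suc (ℕP.≰⇒> x≰xs) | <⇒∃+suc (ℕP.≰⇒> b+e≰y)
      ...   | i , refl | j , y+j≡b+e = no-steeper-crossing {xs} {y} {suc i} {suc j}
              (1≤xs , 1≤y , s≤s z≤n , s≤s z≤n , inside , subst (¬_ ∘ In xs) (sym y+j≡b+e) shifted-out)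
              (subst (_< level d e (xs + suc i) y) (cong (level d e xs) (sym y+j≡b+e))
                     (subst (_< level d e (xs + suc i) y) (sym (level-along d e xs b)) c<L))

    ¬In⇒level≥ : ∀ {x y} → 1 ≤ x → ¬ In x y → c ≤ level d e x y
    ¬In⇒level≥ {x} {y} 1≤x outside = ℕP.≮⇒≥ below
      where
      below : ¬ (level d e x y < c)
      below L<c with a ℕ.≤? x | y ℕ.≤? b
      ... | yes a≤x | _ = outside (In-along-level a≤x (ℕP.<⇒≤ L<c) corner-in)
      ... | no a≰x | yes y≤b = outside (In-downward-closed (ℕP.<⇒≤ (ℕP.≰⇒> a≰x)) y≤b corner-in)
      ... | no a≰x | no y≰b with <⇒∃+suc (ℕP.≰⇒> a≰x) | <⇒∃+suc (ℕP.≰⇒> y≰b)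
      ...   | i , x+i≡a | j , refl = no-steeper-crossing {x} {b} {suc i} {suc j}
              (1≤x , 1≤b , s≤s z≤n , s≤s z≤n , subst (λ z → In z b) (sym x+i≡a) corner-in , outside)
              (subst (level d e x (b + suc j) <_) (cong (λ z → level d e z b) (sym x+i≡a)) L<c)

    private
      -- Splitting the step (d , e) into two positive steps of no greater slope would produce a
      -- narrower crossing of least slope, through (xs + d₁ , b + e₀) or on either side of it.
      no-split : ∀ {d₀ d₁ e₀ e₁} → d₀ + d₁ ≡ d → e₀ + e₁ ≡ e → 1 ≤ d₀ → 1 ≤ d₁ → 1 ≤ e₀ → 1 ≤ e₁ →
                 e₀ * d ≤ e * d₀ → e₁ * d ≤ e * d₁ → ⊥
      no-split {d₀} {d₁} {e₀} {e₁} d₀+d₁≡d e₀+e₁≡e 1≤d₀ 1≤d₁ 1≤e₀ 1≤e₁ slope₀ slope₁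
        with U * (xs + d₁) + V * (b + e₀) ℕ.≤? T
      ... | yes mid-in = ℕP.<-irrefl refl (ℕP.<-≤-trans d₁<d (least-width
              (1≤xs , ℕP.≤-trans 1≤b (ℕP.m≤m+n b e₀) , 1≤d₁ , 1≤e₁ , mid-in ,
               subst (¬_ ∘ In xs) (trans (cong (λ z → b + z) (sym e₀+e₁≡e)) (sym (ℕP.+-assoc b e₀ e₁))) shifted-out)
              slope₁))
        where
        d₁<d : d₁ < d
        d₁<d = subst (d₁ <_) d₀+d₁≡d (ℕP.m<n+m d₁ 1≤d₀)
      ... | no mid-out = ℕP.<-irrefl refl (ℕP.<-≤-trans d₀<d (least-width
              (ℕP.≤-trans 1≤xs (ℕP.m≤m+n xs d₁) , 1≤b , 1≤d₀ , 1≤e₀ ,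
               subst (λ z → In z b) (sym xs+d₁+d₀≡a) corner-in , mid-out)
              slope₀))
        where
        d₀<d : d₀ < d
        d₀<d = subst (d₀ <_) d₀+d₁≡d (ℕP.m<m+n d₀ 1≤d₁)
        xs+d₁+d₀≡a : xs + d₁ + d₀ ≡ a
        xs+d₁+d₀≡a = trans (ℕP.+-assoc xs d₁ d₀) (cong (λ z → xs + z) (trans (ℕP.+-comm d₁ d₀) d₀+d₁≡d))

    least-crossing-coprime : Coprime d e
    least-crossing-coprime {zero} (divides q₁ d≡q₁*0 , _) =
      ⊥-elim (ℕP.<-irrefl refl (ℕP.≤-trans 1≤d (ℕP.≤-reflexive (trans d≡q₁*0 (ℕP.*-zeroʳ q₁)))))
    least-crossing-coprime {suc zero} _ = refl
    least-crossing-coprime {suc (suc m)} (divides q₁ d≡q₁*k , divides q₂ e≡q₂*k) =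
      ⊥-elim (no-split (split q₁ d≡q₁*k) (split q₂ e≡q₂*k) 1≤q₁ (ℕP.*-mono-≤ 1≤q₁ (s≤s z≤n))
                       1≤q₂ (ℕP.*-mono-≤ 1≤q₂ (s≤s z≤n))
                       (ℕP.≤-reflexive (subst₂ (λ d e → q₂ * d ≡ e * q₁) (sym d≡q₁*k) (sym e≡q₂*k) (regroup₀ q₁ q₂ k)))
                       (ℕP.≤-reflexive (subst₂ (λ d e → q₂ * suc m * d ≡ e * (q₁ * suc m)) (sym d≡q₁*k) (sym e≡q₂*k)
                                               (regroup₁ q₁ q₂ k (suc m)))))
      where
      k : ℕ
      k = suc (suc m)
      split : ∀ {n} q → n ≡ q * k → q + q * suc m ≡ n
      split q n≡q*k = trans (sym (ℕP.*-suc q (suc m))) (sym n≡q*k)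
      positive-quotient : ∀ {n} q → 1 ≤ n → n ≡ q * k → 1 ≤ q
      positive-quotient zero    1≤n n≡0 = ⊥-elim (ℕP.<-irrefl refl (ℕP.≤-trans 1≤n (ℕP.≤-reflexive n≡0)))
      positive-quotient (suc q) _   _   = s≤s z≤n
      1≤q₁ : 1 ≤ q₁
      1≤q₁ = positive-quotient q₁ 1≤d d≡q₁*k
      1≤q₂ : 1 ≤ q₂
      1≤q₂ = positive-quotient q₂ 1≤e e≡q₂*k
      regroup₀ : ∀ a b k → b * (a * k) ≡ b * k * a
      regroup₀ = ℕSolver.solve-∀
      regroup₁ : ∀ a b k n → b * n * (a * k) ≡ b * k * (a * n)
      regroup₁ = ℕSolver.solve-∀

    private
      inside⇒below : ∀ {x y} → 1 ≤ y → In x y → level d e x y < c ⊎ (level d e x y ≡ c × y ≤ b)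
      inside⇒below {x} {y} 1≤y inside with ℕP.m≤n⇒m<n∨m≡n (In⇒level≤ 1≤y inside)
      ... | inj₁ L<c = inj₁ L<c
      ... | inj₂ L≡c = inj₂ (L≡c , ℕP.≮⇒≥ above-corner)
        where
        above-corner : ¬ (b < y)
        above-corner b<y = shifted-out
          (In-along-level x≤xs (ℕP.≤-reflexive (trans (level-along d e xs b) (sym L≡c))) inside)
          where
          x<a : x < a
          x<a = ℕP.≰⇒> λ a≤x → ℕP.<-irrefl (sym L≡c) (level-<-monoʸ {d} {e} 1≤d a≤x b<y)
          x≤xs : x ≤ xs
          x≤xs = ℕP.+-cancelʳ-≤ d x xs (proj₁ (level-≡-gap 1≤e least-crossing-coprime L≡c x<a))

      below⇒inside : ∀ {x y} → 1 ≤ x → level d e x y < c ⊎ (level d e x y ≡ c × y ≤ b) → In x y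
      below⇒inside 1≤x (inj₁ L<c) =
        ℕP.≮⇒≥ λ T<W → ℕP.<-irrefl refl (ℕP.<-≤-trans L<c (¬In⇒level≥ 1≤x (ℕP.<⇒≱ T<W)))
      below⇒inside {x} {y} 1≤x (inj₂ (L≡c , y≤b)) = In-along-level a≤x (ℕP.≤-reflexive L≡c) corner-in
        where
        a≤x : a ≤ x
        a≤x = ℕP.≮⇒≥ λ x<a → ℕP.<-irrefl L≡c (level-<-mono {d} {e} 1≤e x<a y≤b)

    Triangle⇔Below : ∀ x y → Triangle U V T x y ⇔ Below (a , b , d , e) x y
    Triangle⇔Below x y = mk⇔ (λ (1≤x , 1≤y , inside) → 1≤x , 1≤y , inside⇒below 1≤y inside)
                             (λ (1≤x , 1≤y , below) → 1≤x , 1≤y , below⇒inside 1≤x below)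

    least-crossing-Φ : ∀ {τ} → (∀ x y → Mem τ x y ⇔ Triangle U V T x y) →
                       Φ τ (a , b , d , e) × (∀ x y → Mem τ x y ⇔ Below (a , b , d , e) x y)
    least-crossing-Φ {τ} τ-triangle = Below⇒Φ 1≤b 1≤d 1≤e (ℕP.m<n+m d 1≤xs) least-crossing-coprime {τ} τ-cells , τ-cells
      where
      τ-cells : ∀ x y → Mem τ x y ⇔ Below (a , b , d , e) x y
      τ-cells x y = ⇔-trans (τ-triangle x y) (Triangle⇔Below x y)

φ-exists : ∀ τ → InΔ τ → ¬ InI τ → ∃ λ q → Φ τ q × (∀ x y → Mem τ x y ⇔ Below q x y)
φ-exists τ (τ-ptn , τ-triangular) ¬I = from-triangle (triangular⇒integral τ-triangular)
  where
  from-triangle : IntegralTriangle (Mem τ) → ∃ λ q → Φ τ q × (∀ x y → Mem τ x y ⇔ Below q x y)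
  from-triangle record { U = U ; V = V ; T = T ; U-pos = 1≤U ; V-pos = 1≤V ; cells = cells } =
    _ , least-crossing-Φ (proj₂ (least-crossing (proj₂ (proj₂ (to (cells 2 1) (¬InI⇒Mem-2-1 τ-ptn ¬I)))))) {τ} cells
    where open Crossings U V T 1≤U 1≤V

Φ⇒Below : ∀ {τ q} → InΔ τ → ¬ InI τ → Φ τ q → ∀ x y → Mem τ x y ⇔ Below q x y
Φ⇒Below {τ} τ∈Δ ¬I Φτq =
  let _ , Φτq' , τ-cells = φ-exists τ τ∈Δ ¬I
  in subst (λ q → ∀ x y → Mem τ x y ⇔ Below q x y) (φ-functional {τ} Φτq' Φτq) τ-cells

lemma7p5 :
    (∀ τ → InΔ τ → ¬ InI τ →
      Σ (ℕ × ℕ × ℕ × ℕ) λ q → Φ τ q × (∀ q' → Φ τ q' → q' ≡ q))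
    × (∀ τ q → InΔ τ → ¬ InI τ → Φ τ q → InQ q)
    × (∀ q → InQ q →
      Σ (List ℕ) λ τ → InΔ τ × ¬ InI τ × Φ τ q
        × (∀ τ' → InΔ τ' → ¬ InI τ' → Φ τ' q → τ' ≡ τ))
lemma7p5 = φ-unique , (λ τ _ _ _ → Φ⇒InQ {τ}) , φ⁻¹-unique
  where
  φ-unique : ∀ τ → InΔ τ → ¬ InI τ → Σ (ℕ × ℕ × ℕ × ℕ) λ q → Φ τ q × (∀ q' → Φ τ q' → q' ≡ q)
  φ-unique τ τ∈Δ ¬I =
    let q , Φτq , _ = φ-exists τ τ∈Δ ¬I
    in q , Φτq , λ _ Φτq' → φ-functional {τ} Φτq' Φτq

  φ⁻¹-unique : ∀ q → InQ q → Σ (List ℕ) λ τ → InΔ τ × ¬ InI τ × Φ τ q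
                 × (∀ τ' → InΔ τ' → ¬ InI τ' → Φ τ' q → τ' ≡ τ)
  φ⁻¹-unique q q∈Q =
    let τ , τ∈Δ , ¬I , Φτq = φ-preimage q∈Q
    in τ , τ∈Δ , ¬I , Φτq , λ τ' τ'∈Δ ¬I' Φτ'q →
         partition-ext (proj₁ τ'∈Δ) (proj₁ τ∈Δ) λ x y →
           ⇔-trans (Φ⇒Below {τ'} τ'∈Δ ¬I' Φτ'q x y) (⇔-sym (Φ⇒Below {τ} τ∈Δ ¬I Φτq x y))
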